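{- For all $A \in \Gamma_\theta$, $\mathfrak{S}(A^{ -1}) = -\mathfrak{S}(A)$.
   Context: $\Gamma_\theta = \{\begin{pmatrix} a&b\\c&d\end{pmatrix}\in \mathrm{SL}_2(\mathbf{Z}) : a\equiv d,\ b\equiv c \pmod 2\}$. For $A=\begin{pmatrix} a&b\\c&d\end{pmatrix}\in\Gamma_\theta$, $\mathfrak{S}(A)=\sum_{k=1}^{|c|-1}(-1)^{\lfloor ka/c\rfloor+k+1}$ if $c\neq 0$, and $\mathfrak{S}(A)=0$ if $c=0$. -}

module Defs where

open import Data.Nat as ℕ using (ℕ; zero; suc)
open import Data.Integer as ℤ using (ℤ; +_; -[1+_]; _+_; _*_; _-_; -_; ∣_∣; _/ℕ_)
open import Data.Nat.Divisibility using (_∣_)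
open import Data.Integer.Divisibility as ℤD using ()
open import Relation.Binary.PropositionalEquality using (_≡_)
open import Data.Product using (_×_)

_≡₂_ : ℤ → ℤ → Set
a ≡₂ b = (+ 2) ℤD.∣ (a - b)

record Mat : Set where
  constructor mat
  field
    a b c d : ℤ

InΓθ : Mat → Set
InΓθ (mat a b c d) = (a * d - b * c ≡ + 1) × (a ≡₂ d) × (b ≡₂ c)

-- ⌊ x / c ⌋ for c ≠ 0 (value at c = 0 is irrelevant: set to 0)
floorDiv : ℤ → ℤ → ℤ
floorDiv x (+ zero)    = + 0
floorDiv x (+ suc n)   = x /ℕ suc n
floorDiv x -[1+ n ]    = (- x) /ℕ suc n

negOnePow : ℤ → ℤ
negOnePow m with ∣ m ∣ ℕ.% 2
... | zero = + 1
... | suc _ = - (+ 1)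

sumFrom1 : ℕ → (ℕ → ℤ) → ℤ
sumFrom1 zero    f = + 0
sumFrom1 (suc N) f = sumFrom1 N f + f (suc N)

𝔖 : Mat → ℤ
𝔖 (mat a b (+ zero) d) = + 0
𝔖 (mat a b c d) = sumFrom1 (∣ c ∣ ℕ.∸ 1)
                    (λ k → negOnePow (floorDiv (+ k * a) c + + k + + 1))

inv : Mat → Mat
inv (mat a b c d) = mat d (- b) (- c) a

-- For c > 0 the determinant condition gives a d ≡ 1 (mod c), so k ↦ k a mod c
-- permutes {1, …, c − 1} with inverse r ↦ r d mod c.  Writing k a = r + q c and
-- r d = k + M c, one finds ⌊−r d / c⌋ = −M − 1, so the summand of 𝔖(A⁻¹) at r has
-- exponent −M + r = k (a − b) + q (d − c) ≡ k + q (mod 2), because Γθ forces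
-- a − b and d − c to be odd, whereas the summand of 𝔖(A) at k has exponent
-- q + k + 1.  Reindexing along k ↦ k a mod c therefore turns 𝔖(A⁻¹) into −𝔖(A).
-- The case c < 0 is the case c > 0 applied to A⁻¹.
module Submission where

open import Defs
open import Data.Fin as Fin using (Fin; toℕ; fromℕ<)
import Data.Fin.Properties as Fin
open import Data.Fin.Permutation using (Permutation; permutation)
open import Data.Integer as ℤ
  using (ℤ; +_; -[1+_]; _+_; _*_; _-_; -_; ∣_∣; _/ℕ_; _%ℕ_; _≤_; _<_; +<+)
open import Data.Integer.DivMod using (a≡a%ℕn+[a/ℕn]*n; [n/ℕd]*d≤n; n<s[n/ℕd]*d; n%ℕd<d)
open import Data.Integer.Divisibility.Signed
  using (_∣_; divides; ∣ᵤ⇒∣; ∣m∣n⇒∣m+n; ∣m∣n⇒∣m-n; ∣n⇒∣m*n)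
open import Data.Integer.Properties
open import Algebra.Properties.CommutativeMonoid.Sum +-0-commutativeMonoid
  using (sum; sum-permute; sum-cong-≗; sum-init-last)
open import Algebra.Properties.AbelianGroup +-0-abelianGroup using (∙-cancelʳ; x≈z//y)
open import Data.Integer.Tactic.RingSolver using (solve-∀; solve)
open import Data.List using ([]; _∷_)
open import Data.Nat as ℕ using (ℕ; zero; suc; _∸_; s≤s; z≤n; s≤s⁻¹)
import Data.Nat.Divisibility as ℕD
import Data.Nat.Properties as ℕP
open import Data.Product using (_×_; _,_; proj₁; proj₂)
open import Function using (_∘_)
open import Relation.Binary.PropositionalEquality
open import Relation.Nullary.Negation using (contradiction)

open ≡-Reasoning

negOnePow-1+ : ∀ n → negOnePow (+ suc n) ≡ - negOnePow (+ n)
negOnePow-1+ zero          = refl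
negOnePow-1+ (suc zero)    = refl
negOnePow-1+ (suc (suc n)) = negOnePow-1+ n

negOnePow-suc : ∀ x → negOnePow (x + + 1) ≡ - negOnePow x
negOnePow-suc (+ n) rewrite ℕP.+-comm n 1 = negOnePow-1+ n
negOnePow-suc -[1+ zero ]  = refl
negOnePow-suc -[1+ suc n ] = begin
  negOnePow (+ suc n)          ≡⟨ neg-involutive _ ⟨
  - - negOnePow (+ suc n)      ≡⟨ cong -_ (negOnePow-1+ (suc n)) ⟨
  - negOnePow (+ suc (suc n))  ∎

negOnePow-pred : ∀ x → negOnePow (x - + 1) ≡ - negOnePow x
negOnePow-pred x = begin
  negOnePow (x - + 1)          ≡⟨ neg-involutive _ ⟨
  - - negOnePow (x - + 1)      ≡⟨ cong -_ (negOnePow-suc (x - + 1)) ⟨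
  - negOnePow (x - + 1 + + 1)  ≡⟨ cong (-_ ∘ negOnePow) (x-1+1≡x x) ⟩
  - negOnePow x                ∎
  where
  x-1+1≡x : ∀ x → x - + 1 + + 1 ≡ x
  x-1+1≡x = solve-∀

negOnePow-+even : ∀ x k → negOnePow (x + + k * + 2) ≡ negOnePow x
negOnePow-+even x zero    = cong negOnePow (+-identityʳ x)
negOnePow-+even x (suc k) = begin
  negOnePow (x + + suc k * + 2)          ≡⟨ cong negOnePow (shift x (+ k)) ⟩
  negOnePow (x + + k * + 2 + + 1 + + 1)  ≡⟨ negOnePow-suc (x + + k * + 2 + + 1) ⟩
  - negOnePow (x + + k * + 2 + + 1)      ≡⟨ cong -_ (negOnePow-suc (x + + k * + 2)) ⟩
  - - negOnePow (x + + k * + 2)          ≡⟨ neg-involutive _ ⟩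
  negOnePow (x + + k * + 2)              ≡⟨ negOnePow-+even x k ⟩
  negOnePow x                            ∎
  where
  shift : ∀ x k → x + (+ 1 + k) * + 2 ≡ x + k * + 2 + + 1 + + 1
  shift = solve-∀

negOnePow-+2* : ∀ x q → negOnePow (x + q * + 2) ≡ negOnePow x
negOnePow-+2* x (+ k)    = negOnePow-+even x k
negOnePow-+2* x -[1+ k ] = begin
  negOnePow (x + -[1+ k ] * + 2)                   ≡⟨ negOnePow-+even (x + -[1+ k ] * + 2) (suc k) ⟨
  negOnePow (x + -[1+ k ] * + 2 + + suc k * + 2)  ≡⟨ cong negOnePow (cancel x (+ suc k)) ⟩
  negOnePow x                                      ∎
  where
  cancel : ∀ x j → x + - j * + 2 + j * + 2 ≡ x
  cancel = solve-∀

negOnePow-cong-mod2 : ∀ {x y} → + 2 ∣ x - y → negOnePow x ≡ negOnePow y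
negOnePow-cong-mod2 {x} {y} (divides q x-y≡2q) = begin
  negOnePow x              ≡⟨ cong negOnePow (x≡y+[x-y] x y) ⟩
  negOnePow (y + (x - y))  ≡⟨ cong (λ t → negOnePow (y + t)) x-y≡2q ⟩
  negOnePow (y + q * + 2)  ≡⟨ negOnePow-+2* y q ⟩
  negOnePow y              ∎
  where
  x≡y+[x-y] : ∀ x y → x ≡ y + (x - y)
  x≡y+[x-y] = solve-∀

2∣n*[n-1] : ∀ n → + 2 ∣ n * (n - + 1)
2∣n*[n-1] n with n %ℕ 2 | n /ℕ 2 | a≡a%ℕn+[a/ℕn]*n n 2 | n%ℕd<d n 2
... | zero  | h | n≡2h | _ = divides (h * (n - + 1)) (begin
  n * (n - + 1)              ≡⟨ cong (_* (n - + 1)) n≡2h ⟩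
  (+ 0 + h * + 2) * (n - + 1) ≡⟨ solve (h ∷ n ∷ []) ⟩
  h * (n - + 1) * + 2        ∎)
... | suc zero | h | n≡2h+1 | _ = divides (n * h) (begin
  n * (n - + 1)                ≡⟨ cong (λ t → n * (t - + 1)) n≡2h+1 ⟩
  n * (+ 1 + h * + 2 - + 1)   ≡⟨ solve (h ∷ n ∷ []) ⟩
  n * h * + 2                  ∎)
... | suc (suc _) | _ | _ | s≤s (s≤s ())

≡₂-sym : ∀ {x y} → x ≡₂ y → y ≡₂ x
≡₂-sym {x} {y} = subst (2 ℕD.∣_) (∣i-j∣≡∣j-i∣ x y)

≡₂-neg : ∀ {x y} → x ≡₂ y → (- x) ≡₂ (- y)
≡₂-neg {x} {y} = subst (2 ℕD.∣_) (trans (sym (∣-i∣≡∣i∣ (x - y))) (cong ∣_∣ (neg-distrib-- x y)))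
  where
  neg-distrib-- : ∀ x y → - (x - y) ≡ - x - - y
  neg-distrib-- = solve-∀

inv-InΓθ : ∀ {A} → InΓθ A → InΓθ (inv A)
inv-InΓθ {mat a b c d} (det , a≡d , b≡c) =
  trans (det-inv a b c d) det , ≡₂-sym {a} {d} a≡d , ≡₂-neg {b} {c} b≡c
  where
  det-inv : ∀ a b c d → d * a - (- b) * (- c) ≡ a * d - b * c
  det-inv = solve-∀

inv-involutive : ∀ A → inv (inv A) ≡ A
inv-involutive (mat a b c d) = cong₂ (λ b′ c′ → mat a b′ c′ d) (neg-involutive b) (neg-involutive c)

-- Modulo 2: 1 = a d − b c ≡ a² − b² ≡ a − b, and likewise 1 ≡ d² − c² ≡ d − c.
InΓθ⇒odd : ∀ {a b c d} → InΓθ (mat a b c d) → (+ 2 ∣ a - b - + 1) × (+ 2 ∣ d - c - + 1)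
InΓθ⇒odd {a} {b} {c} {d} (det , a≡d , b≡c) =
    subst (+ 2 ∣_) (sym (a-b-1≡ a b c d))
      (∣m∣n⇒∣m+n (∣m∣n⇒∣m-n (∣m∣n⇒∣m-n (∣m∣n⇒∣m+n 2∣det-1 (∣n⇒∣m*n a 2∣a-d)) (∣n⇒∣m*n b 2∣b-c))
                              (2∣n*[n-1] a))
                 (2∣n*[n-1] b))
  , subst (+ 2 ∣_) (sym (d-c-1≡ a b c d))
      (∣m∣n⇒∣m+n (∣m∣n⇒∣m-n (∣m∣n⇒∣m+n (∣m∣n⇒∣m-n 2∣det-1 (∣n⇒∣m*n d 2∣a-d)) (∣n⇒∣m*n c 2∣b-c))
                              (2∣n*[n-1] d))
                 (2∣n*[n-1] c))
  where
  a-b-1≡ : ∀ a b c d → a - b - + 1 ≡ (a * d - b * c - + 1) + a * (a - d) - b * (b - c) - a * (a - + 1) + b * (b - + 1)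
  a-b-1≡ = solve-∀
  d-c-1≡ : ∀ a b c d → d - c - + 1 ≡ (a * d - b * c - + 1) - d * (a - d) + c * (b - c) - d * (d - + 1) + c * (c - + 1)
  d-c-1≡ = solve-∀
  2∣det-1 : + 2 ∣ a * d - b * c - + 1
  2∣det-1 = subst (λ t → + 2 ∣ t - + 1) (sym det) (divides (+ 0) refl)
  2∣a-d : + 2 ∣ a - d
  2∣a-d = ∣ᵤ⇒∣ a≡d
  2∣b-c : + 2 ∣ b - c
  2∣b-c = ∣ᵤ⇒∣ b≡c

quotient-≤ : ∀ {i j x} d .{{_ : ℕ.NonZero d}} → i * + d ≤ x → x < ℤ.suc j * + d → i ≤ j
quotient-≤ d id≤x x<[1+j]d =
  ≮⇒≥ λ j<i → <⇒≱ (*-cancelʳ-<-nonNeg (+ d) (≤-<-trans id≤x x<[1+j]d)) (i<j⇒suc[i]≤j j<i)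

/ℕ-unique : ∀ {x q r} d .{{_ : ℕ.NonZero d}} → r ℕ.< d → x ≡ + r + q * + d → x /ℕ d ≡ q
/ℕ-unique {q = q} {r} d r<d refl = ≤-antisym
  (quotient-≤ d ([n/ℕd]*d≤n (+ r + q * + d) d)
    (subst (+ r + q * + d <_) (sym (suc-* q (+ d))) (+-monoˡ-< (q * + d) (+<+ r<d))))
  (quotient-≤ d (i≤j+i (q * + d) (+ r)) (n<s[n/ℕd]*d (+ r + q * + d) d))

%ℕ-unique : ∀ {x q r} d .{{_ : ℕ.NonZero d}} → r ℕ.< d → x ≡ + r + q * + d → x %ℕ d ≡ r
%ℕ-unique {x} {q} {r} d r<d x≡r+qd = +-injective (∙-cancelʳ (q * + d) _ _ (begin
  + (x %ℕ d) + q * + d         ≡⟨ cong (λ t → + (x %ℕ d) + t * + d) (/ℕ-unique {x} {q} {r} d r<d x≡r+qd) ⟨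
  + (x %ℕ d) + (x /ℕ d) * + d  ≡⟨ a≡a%ℕn+[a/ℕn]*n x d ⟨
  x                             ≡⟨ x≡r+qd ⟩
  + r + q * + d                 ∎))

_∈[1,_] : ℕ → ℕ → Set
k ∈[1, n ] = 1 ℕ.≤ k × k ℕ.≤ n

sumFrom1-cong : ∀ n {f g : ℕ → ℤ} → (∀ {k} → k ∈[1, n ] → f k ≡ g k) → sumFrom1 n f ≡ sumFrom1 n g
sumFrom1-cong zero    f≗g = refl
sumFrom1-cong (suc n) f≗g =
  cong₂ _+_ (sumFrom1-cong n (λ (1≤k , k≤n) → f≗g (1≤k , ℕP.m≤n⇒m≤1+n k≤n))) (f≗g (s≤s z≤n , ℕP.≤-refl))

sumFrom1-neg : ∀ n f → sumFrom1 n (-_ ∘ f) ≡ - sumFrom1 n f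
sumFrom1-neg zero    f = refl
sumFrom1-neg (suc n) f =
  trans (cong (_+ - f (suc n)) (sumFrom1-neg n f)) (sym (neg-distrib-+ (sumFrom1 n f) (f (suc n))))

module _ {n : ℕ} where

  fromFin : Fin n → ℕ
  fromFin i = suc (toℕ i)

  fromFin-∈ : ∀ i → fromFin i ∈[1, n ]
  fromFin-∈ i = s≤s z≤n , Fin.toℕ<n i

  fromFin-injective : ∀ {i j} → fromFin i ≡ fromFin j → i ≡ j
  fromFin-injective = Fin.toℕ-injective ∘ ℕP.suc-injective

  toFin : ∀ {k} → k ∈[1, n ] → Fin n
  toFin {suc k} (_ , k<n) = fromℕ< k<n

  fromFin-toFin : ∀ {k} (k∈ : k ∈[1, n ]) → fromFin (toFin k∈) ≡ k
  fromFin-toFin {suc k} (_ , k<n) = cong suc (Fin.toℕ-fromℕ< k<n)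

sumFrom1-as-sum : ∀ n f → sumFrom1 n f ≡ sum (f ∘ fromFin {n})
sumFrom1-as-sum zero    f = refl
sumFrom1-as-sum (suc n) f = begin
  sumFrom1 n f + f (suc n)               ≡⟨ cong₂ _+_ init≡ last≡ ⟩
  sum (F ∘ Fin.inject₁) + F (Fin.fromℕ n)  ≡⟨ sum-init-last F ⟨
  sum F                                  ∎
  where
  F : Fin (suc n) → ℤ
  F = f ∘ fromFin
  init≡ : sumFrom1 n f ≡ sum (F ∘ Fin.inject₁)
  init≡ = trans (sumFrom1-as-sum n f) (sum-cong-≗ {n} (λ i → cong (f ∘ suc) (sym (Fin.toℕ-inject₁ i))))
  last≡ : f (suc n) ≡ F (Fin.fromℕ n)
  last≡ = cong (f ∘ suc) (sym (Fin.toℕ-fromℕ n))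

sumFrom1-reindex : ∀ n (π ρ : ℕ → ℕ) →
                   (∀ {k} → k ∈[1, n ] → π k ∈[1, n ]) → (∀ {k} → k ∈[1, n ] → ρ k ∈[1, n ]) →
                   (∀ {k} → k ∈[1, n ] → π (ρ k) ≡ k) → (∀ {k} → k ∈[1, n ] → ρ (π k) ≡ k) →
                   ∀ f → sumFrom1 n (f ∘ π) ≡ sumFrom1 n f
sumFrom1-reindex n π ρ π-∈ ρ-∈ πρ ρπ f = begin
  sumFrom1 n (f ∘ π)             ≡⟨ sumFrom1-as-sum n (f ∘ π) ⟩
  sum {n} (f ∘ π ∘ fromFin)      ≡⟨ sum-cong-≗ (λ i → cong f (sym (fromFin-σ i))) ⟩
  sum {n} (f ∘ fromFin ∘ σ)      ≡⟨ sum-permute (f ∘ fromFin) σ↔ ⟨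
  sum {n} (f ∘ fromFin)          ≡⟨ sumFrom1-as-sum n f ⟨
  sumFrom1 n f                   ∎
  where
  σ τ : Fin n → Fin n
  σ = toFin ∘ π-∈ ∘ fromFin-∈
  τ = toFin ∘ ρ-∈ ∘ fromFin-∈
  fromFin-σ : ∀ i → fromFin (σ i) ≡ π (fromFin i)
  fromFin-σ = fromFin-toFin ∘ π-∈ ∘ fromFin-∈
  fromFin-τ : ∀ i → fromFin (τ i) ≡ ρ (fromFin i)
  fromFin-τ = fromFin-toFin ∘ ρ-∈ ∘ fromFin-∈
  σ∘τ : ∀ i → σ (τ i) ≡ i
  σ∘τ i = fromFin-injective (begin
    fromFin (σ (τ i))  ≡⟨ fromFin-σ (τ i) ⟩
    π (fromFin (τ i))  ≡⟨ cong π (fromFin-τ i) ⟩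
    π (ρ (fromFin i))  ≡⟨ πρ (fromFin-∈ i) ⟩
    fromFin i          ∎)
  τ∘σ : ∀ i → τ (σ i) ≡ i
  τ∘σ i = fromFin-injective (begin
    fromFin (τ (σ i))  ≡⟨ fromFin-τ (σ i) ⟩
    ρ (fromFin (σ i))  ≡⟨ cong ρ (fromFin-σ i) ⟩
    ρ (π (fromFin i))  ≡⟨ ρπ (fromFin-∈ i) ⟩
    fromFin i          ∎)
  σ↔ : Permutation n n
  σ↔ = permutation σ τ σ∘τ τ∘σ

𝔖-summand : ℤ → ℤ → ℕ → ℤ
𝔖-summand a c k = negOnePow (floorDiv (+ k * a) c + + k + + 1)

module ModularInverse (n : ℕ) (a d b : ℤ) (ad-bm≡1 : a * d - b * + suc n ≡ + 1) where

  private
    m : ℤ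
    m = + suc n

    ⌊ka/m⌋ : ℕ → ℤ
    ⌊ka/m⌋ k = (+ k * a) /ℕ suc n

  ×a%m : ℕ → ℕ
  ×a%m k = (+ k * a) %ℕ suc n

  private
    ka%m≡ : ∀ k → + ×a%m k ≡ + k * a - ⌊ka/m⌋ k * m
    ka%m≡ k = x≈z//y _ _ _ (sym (a≡a%ℕn+[a/ℕn]*n (+ k * a) (suc n)))

    M : ℕ → ℤ
    M k = + k * b - ⌊ka/m⌋ k * d

    [ka%m]*d≡ : ∀ k → + ×a%m k * d ≡ + k + M k * m
    [ka%m]*d≡ k = begin
      + ×a%m k * d                          ≡⟨ cong (_* d) (ka%m≡ k) ⟩
      (+ k * a - ⌊ka/m⌋ k * m) * d          ≡⟨ expand (+ k) a b d (⌊ka/m⌋ k) m ⟩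
      + k * (a * d - b * m) + M k * m       ≡⟨ cong (λ t → + k * t + M k * m) ad-bm≡1 ⟩
      + k * + 1 + M k * m                   ≡⟨ cong (_+ M k * m) (*-identityʳ (+ k)) ⟩
      + k + M k * m                         ∎
      where
      expand : ∀ j a b d q m → (j * a - q * m) * d ≡ j * (a * d - b * m) + (j * b - q * d) * m
      expand = solve-∀

  ×d%m∘×a%m : ∀ {k} → k ∈[1, n ] → (+ ×a%m k * d) %ℕ suc n ≡ k
  ×d%m∘×a%m {k} (_ , k≤n) = %ℕ-unique {q = M k} (suc n) (s≤s k≤n) ([ka%m]*d≡ k)

  ×a%m-∈ : ∀ {k} → k ∈[1, n ] → ×a%m k ∈[1, n ]
  ×a%m-∈ {k} k∈@(1≤k , _) with ×a%m k | ×d%m∘×a%m k∈ | n%ℕd<d (+ k * a) (suc n)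
  ... | zero  | 0≡k | _   = contradiction 0≡k (ℕP.<⇒≢ 1≤k)
  ... | suc _ | _   | r<m = s≤s z≤n , s≤s⁻¹ r<m

  ⌊-[ka%m]*d/m⌋ : ∀ {k} → k ∈[1, n ] → (- (+ ×a%m k * d)) /ℕ suc n ≡ - M k - + 1
  ⌊-[ka%m]*d/m⌋ {k} (1≤k , k≤n) =
    /ℕ-unique {q = - M k - + 1} (suc n) (ℕP.∸-monoʳ-< 1≤k (ℕP.m≤n⇒m≤1+n k≤n)) (begin
    - (+ ×a%m k * d)                  ≡⟨ cong -_ ([ka%m]*d≡ k) ⟩
    - (+ k + M k * m)                 ≡⟨ reflect (+ k) (M k) m ⟩
    (m - + k) + (- M k - + 1) * m     ≡⟨ cong (_+ (- M k - + 1) * m) m-k≡m∸k ⟩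
    + (suc n ∸ k) + (- M k - + 1) * m ∎)
    where
    reflect : ∀ j M m → - (j + M * m) ≡ (m - j) + (- M - + 1) * m
    reflect = solve-∀
    m-k≡m∸k : m - + k ≡ + (suc n ∸ k)
    m-k≡m∸k = trans (m-n≡m⊖n (suc n) k) (⊖-≥ (ℕP.m≤n⇒m≤1+n k≤n))

  𝔖-summand-flip : + 2 ∣ a - b - + 1 → + 2 ∣ d - m - + 1 →
                   ∀ {k} → k ∈[1, n ] → 𝔖-summand d -[1+ n ] (×a%m k) ≡ - 𝔖-summand a m k
  𝔖-summand-flip 2∣a-b-1 2∣d-m-1 {k} k∈ = begin
    negOnePow ((- (+ r * d)) /ℕ suc n + + r + + 1)
      ≡⟨ cong (λ t → negOnePow (t + + r + + 1)) (⌊-[ka%m]*d/m⌋ k∈) ⟩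
    negOnePow E′         ≡⟨ negOnePow-cong-mod2 {E′} {E - + 1} 2∣E′-[E-1] ⟩
    negOnePow (E - + 1)  ≡⟨ negOnePow-pred E ⟩
    - negOnePow E        ∎
    where
    r : ℕ
    r = ×a%m k
    q : ℤ
    q = ⌊ka/m⌋ k
    E′ E : ℤ
    E′ = (- M k - + 1) + + r + + 1
    E = q + + k + + 1
    collect : ∀ j a b d q m → (- (j * b - q * d) - + 1) + (j * a - q * m) + + 1 - (q + j + + 1 - + 1)
                              ≡ j * (a - b - + 1) + q * (d - m - + 1)
    collect = solve-∀
    E′-[E-1]≡ : E′ - (E - + 1) ≡ + k * (a - b - + 1) + q * (d - m - + 1)
    E′-[E-1]≡ = begin
      (- M k - + 1) + + r + + 1 - (E - + 1)
        ≡⟨ cong (λ t → (- M k - + 1) + t + + 1 - (E - + 1)) (ka%m≡ k) ⟩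
      (- M k - + 1) + (+ k * a - q * m) + + 1 - (E - + 1)
        ≡⟨ collect (+ k) a b d q m ⟩
      + k * (a - b - + 1) + q * (d - m - + 1) ∎
    2∣E′-[E-1] : + 2 ∣ E′ - (E - + 1)
    2∣E′-[E-1] = subst (+ 2 ∣_) (sym E′-[E-1]≡) (∣m∣n⇒∣m+n (∣n⇒∣m*n (+ k) 2∣a-b-1) (∣n⇒∣m*n q 2∣d-m-1))

𝔖-inv-pos : ∀ {n a b d} → InΓθ (mat a b (+ suc n) d) →
            𝔖 (inv (mat a b (+ suc n) d)) ≡ - 𝔖 (mat a b (+ suc n) d)
𝔖-inv-pos {n} {a} {b} {d} Γ@(det , _) = begin
  sumFrom1 n (𝔖-summand d -[1+ n ])
    ≡⟨ sumFrom1-reindex n A.×a%m D.×a%m A.×a%m-∈ D.×a%m-∈ D.×d%m∘×a%m A.×d%m∘×a%m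
                        (𝔖-summand d -[1+ n ]) ⟨
  sumFrom1 n (𝔖-summand d -[1+ n ] ∘ A.×a%m)
    ≡⟨ sumFrom1-cong n (A.𝔖-summand-flip (proj₁ parity) (proj₂ parity)) ⟩
  sumFrom1 n (-_ ∘ 𝔖-summand a (+ suc n))
    ≡⟨ sumFrom1-neg n (𝔖-summand a (+ suc n)) ⟩
  - sumFrom1 n (𝔖-summand a (+ suc n)) ∎
  where
  module A = ModularInverse n a d b det
  module D = ModularInverse n d a b (trans (cong (_- b * + suc n) (*-comm d a)) det)
  parity : (+ 2 ∣ a - b - + 1) × (+ 2 ∣ d - + suc n - + 1)
  parity = InΓθ⇒odd {a} {b} {+ suc n} {d} Γ

proposition2 : (A : Mat) → InΓθ A → 𝔖 (inv A) ≡ - 𝔖 A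
proposition2 (mat a b (+ zero) d) _ = refl
proposition2 (mat a b (+ suc n) d) Γ = 𝔖-inv-pos {n} {a} {b} {d} Γ
proposition2 A@(mat a b -[1+ n ] d) Γ = begin
  𝔖 (inv A)           ≡⟨ neg-involutive _ ⟨
  - - 𝔖 (inv A)       ≡⟨ cong -_ (𝔖-inv-pos {n} {d} { - b} {a} (inv-InΓθ {A} Γ)) ⟨
  - 𝔖 (inv (inv A))   ≡⟨ cong (-_ ∘ 𝔖) (inv-involutive A) ⟩
  - 𝔖 A               ∎
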